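{- Let $G$ be a finite simple graph, let $U$ be a fixing subgraph of $G$, and let $U_0$ be a spanning subgraph of $G$ isomorphic to $U$. Then $U_0$ is a fixing subgraph of $G$, and if $U$ is a strong fixing subgraph of $G$ then so is $U_0$.
   Context: All graphs are finite and simple; a spanning subgraph of $G$ has vertex set $V(G)$ and edge set contained in $E(G)$. $A(H)$ denotes the automorphism group of $H$; for spanning subgraphs of $G$ these are subgroups of the symmetric group on $V(G)$. $s(U;G)$ is the number of spanning subgraphs of $G$ isomorphic to $U$. A spanning subgraph $U$ of $G$ is a fixing subgraph of $G$ if $s(U;G)=|A(G)|/|A(U)\cap A(G)|$, and a strong fixing subgraph of $G$ if moreover $A(U)\subseteq A(G)$ (equivalently $s(U;G)=|A(G)|/|A(U)|$). -}

module Defs where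

open import Data.Nat using (ℕ; _*_)
open import Data.Fin using (Fin)
open import Data.Bool using (Bool; true; false)
open import Data.Product using (Σ; ∃; _×_; _,_)
open import Data.Fin.Permutation using (Permutation′; _⟨$⟩ʳ_)
open import Relation.Binary.PropositionalEquality using (_≡_)
open import Level using (Level)

record Graph (n : ℕ) : Set where
  field
    adj    : Fin n → Fin n → Bool
    sym    : ∀ i j → adj i j ≡ adj j i
    irrefl : ∀ i → adj i i ≡ false
open Graph public

_≈G_ : ∀ {n} → Graph n → Graph n → Set
H ≈G K = ∀ i j → adj H i j ≡ adj K i j

_≈P_ : ∀ {n} → Permutation′ n → Permutation′ n → Set
π ≈P σ = ∀ i → π ⟨$⟩ʳ i ≡ σ ⟨$⟩ʳ i

SpanningSub : ∀ {n} → Graph n → Graph n → Set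
SpanningSub H G = ∀ i j → adj H i j ≡ true → adj G i j ≡ true

IsAut : ∀ {n} → Graph n → Permutation′ n → Set
IsAut H π = ∀ i j → adj H (π ⟨$⟩ʳ i) (π ⟨$⟩ʳ j) ≡ adj H i j

Isomorphic : ∀ {n} → Graph n → Graph n → Set
Isomorphic H K = Σ (Permutation′ _) λ π → ∀ i j → adj K (π ⟨$⟩ʳ i) (π ⟨$⟩ʳ j) ≡ adj H i j

-- HasSize _≈_ P k : the collection {a | P a}, taken modulo the equality _≈_,
-- has exactly k elements (witnessed by a bijection from Fin k).
HasSize : ∀ {A : Set} → (A → A → Set) → (A → Set) → ℕ → Set
HasSize {A} _≈_ P k =
  Σ (Fin k → A) λ f →
    (∀ i → P (f i)) ×
    (∀ i j → f i ≈ f j → i ≡ j) ×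
    (∀ a → P a → ∃ λ i → f i ≈ a)

SCount : ∀ {n} → Graph n → Graph n → ℕ → Set
SCount U G s = HasSize _≈G_ (λ H → SpanningSub H G × Isomorphic U H) s

AutCount : ∀ {n} → Graph n → ℕ → Set
AutCount G a = HasSize _≈P_ (IsAut G) a

AutCapCount : ∀ {n} → Graph n → Graph n → ℕ → Set
AutCapCount U G b = HasSize _≈P_ (λ π → IsAut U π × IsAut G π) b

-- U is a fixing subgraph of G: U is a spanning subgraph of G and
-- s(U;G) = |A(G)| / |A(U) ∩ A(G)|, stated multiplicatively
-- (s(U;G) · |A(U) ∩ A(G)| = |A(G)|; the denominator is ≥ 1).
IsFixing : ∀ {n} → Graph n → Graph n → Set
IsFixing U G =
  SpanningSub U G ×
  (∀ s a b → SCount U G s → AutCount G a → AutCapCount U G b → s * b ≡ a)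

IsStrongFixing : ∀ {n} → Graph n → Graph n → Set
IsStrongFixing U G = IsFixing U G × (∀ π → IsAut U π → IsAut G π)

-- Let A(G) act on the copies of U in G, i.e. the spanning subgraphs isomorphic to U.
-- Fixing, for every copy in the orbit of U, an automorphism ρ carrying U onto it, the map
-- π ↦ (πU, ρ⁻¹π) injects A(G) into (copies) × (A(U) ∩ A(G)). The fixing equation
-- s(U;G)·|A(U) ∩ A(G)| = |A(G)| makes this injection a bijection, so A(G) is transitive on
-- the copies and U₀ = gU for some g ∈ A(G). Conjugation by g identifies A(U₀) ∩ A(G) with
-- A(U) ∩ A(G) and A(U₀) with A(U), while s(U₀;G) = s(U;G) because U ≅ U₀.
-- Since IsFixing only constrains counts that exist, the counts are first shown to exist by
-- enumerating permutations and adjacency relations.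

module Submission where

open import Defs
open import Data.Bool using (Bool; true; false)
open import Data.Bool.Properties using () renaming (_≟_ to _≟ᵇ_)
open import Data.Empty using (⊥-elim)
open import Data.Fin using (Fin; zero; suc; combine; punchOut; finToFun; funToFin)
open import Data.Fin.Properties
  using (any?; all?; _≟_; 2↔Bool; combine-injectiveˡ; combine-injectiveʳ; injective⇒≤;
         suc-injective; punchOut-injective; finToFun-funToFin; funToFin-finToFin)
open import Data.Fin.Permutation
  using (Permutation′; permutation; _⟨$⟩ʳ_; _⟨$⟩ˡ_; inverseˡ; inverseʳ; flip; _∘ₚ_; id)
open import Data.Nat using (ℕ; suc; _*_; _^_; _≤_)
open import Data.Nat.Properties using (≤-refl; ≤-reflexive; ≤-trans; 1+n≰n)
open import Data.Product using (Σ; ∃; _×_; _,_; proj₁; proj₂)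
open import Data.Unit using (⊤; tt)
open import Data.Vec.Functional using (_∷_)
open import Function using (_∘_)
open import Function.Bundles using (_↔_; Inverse)
open import Function.Construct.Identity using (↔-id)
open import Function.Definitions using (Injective)
open import Relation.Nullary using (Dec; yes; no)
open import Relation.Nullary.Decidable using (_×-dec_; _→-dec_)
open import Relation.Binary.PropositionalEquality as ≡ using (_≡_; refl; trans; cong; cong₂; subst)

private
  variable
    k n : ℕ
    A : Set
    U H K G : Graph n
    π σ g : Permutation′ n

HasSize-⇔ : {_≈_ : A → A → Set} {P Q : A → Set} →
  (∀ x → P x → Q x) → (∀ x → Q x → P x) → HasSize _≈_ P k → HasSize _≈_ Q k
HasSize-⇔ P⇒Q Q⇒P (f , f-P , f-inj , f-surj) =
  f , (λ i → P⇒Q _ (f-P i)) , f-inj , λ x Qx → f-surj x (Q⇒P x Qx)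

↔⇒HasSize : Fin k ↔ A → HasSize _≡_ (λ (_ : A) → ⊤) k
↔⇒HasSize e = to , (λ _ → tt) , injective , λ x _ → from x , strictlyInverseˡ x
  where
  open Inverse e
  injective : ∀ i j → to i ≡ to j → i ≡ j
  injective i j eq = trans (≡.sym (strictlyInverseʳ i)) (trans (cong from eq) (strictlyInverseʳ j))

HasSize-Fin-filter : (P : Fin k → Set) → (∀ i → Dec (P i)) → Σ ℕ λ m → HasSize _≡_ P m
HasSize-Fin-filter {ℕ.zero} P P? = 0 , (λ ()) , (λ ()) , (λ ()) , λ ()
HasSize-Fin-filter {suc k} P P? with HasSize-Fin-filter (P ∘ suc) (P? ∘ suc)
... | m , e , e-P , e-inj , e-surj with P? zero
...   | no ¬P0 = m , suc ∘ e , e-P , (λ i j → e-inj i j ∘ suc-injective) , surj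
  where
  surj : ∀ x → P x → ∃ λ i → suc (e i) ≡ x
  surj zero P0 = ⊥-elim (¬P0 P0)
  surj (suc x) Px = let (i , eq) = e-surj x Px in i , cong suc eq
...   | yes P0 = suc m , e′ , e′-P , e′-inj , e′-surj
  where
  e′ : Fin (suc m) → Fin (suc k)
  e′ = zero ∷ (suc ∘ e)
  e′-P : ∀ i → P (e′ i)
  e′-P zero = P0
  e′-P (suc i) = e-P i
  e′-inj : ∀ i j → e′ i ≡ e′ j → i ≡ j
  e′-inj zero zero _ = refl
  e′-inj (suc i) (suc j) eq = cong suc (e-inj i j (suc-injective eq))
  e′-inj zero (suc _) ()
  e′-inj (suc _) zero ()
  e′-surj : ∀ x → P x → ∃ λ i → e′ i ≡ x
  e′-surj zero _ = zero , refl
  e′-surj (suc x) Px = let (i , eq) = e-surj x Px in suc i , cong suc eq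

HasSize-filter : {_≈_ : A → A → Set} {Q : A → Set} → HasSize _≈_ Q k →
  (P : A → Set) → (∀ x → Dec (P x)) → (∀ {x y} → x ≈ y → P y → P x) →
  Σ ℕ λ m → HasSize _≈_ (λ x → Q x × P x) m
HasSize-filter {_≈_ = _≈_} {Q} (f , f-Q , f-inj , f-surj) P P? P-resp
  with HasSize-Fin-filter (P ∘ f) (P? ∘ f)
... | m , e , e-P , e-inj , e-surj =
  m , f ∘ e , (λ i → f-Q (e i) , e-P i) , (λ i j → e-inj i j ∘ f-inj (e i) (e j)) , surj
  where
  surj : ∀ x → Q x × P x → ∃ λ i → f (e i) ≈ x
  surj x (Qx , Px) with f-surj x Qx
  ... | l , fl≈x with e-surj l (P-resp fl≈x Px)
  ...   | i , refl = i , fl≈x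

HasSize-any? : {_≈_ : A → A → Set} → HasSize _≈_ (λ _ → ⊤) k →
  (P : A → Set) → (∀ x → Dec (P x)) → (∀ {x y} → x ≈ y → P y → P x) → Dec (∃ P)
HasSize-any? (f , _ , _ , f-surj) P P? P-resp with any? (P? ∘ f)
... | yes (i , Pfi) = yes (f i , Pfi)
... | no ¬P = no λ (x , Px) → let (i , fi≈x) = f-surj x tt in ¬P (i , P-resp fi≈x Px)

HasSize-→ : {_≈_ : A → A → Set} → HasSize _≈_ (λ _ → ⊤) k →
  ∀ n → HasSize (λ (u v : Fin n → A) → ∀ i → u i ≈ v i) (λ _ → ⊤) (k ^ n)
HasSize-→ {A = A} {k = k} {_≈_ = _≈_} (f , _ , f-inj , f-surj) n =
  (λ c → f ∘ finToFun c) , (λ _ → tt) , inj , λ u _ → funToFin (code u) , decode u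
  where
  funToFin-cong : ∀ {m} {u v : Fin m → Fin k} → (∀ i → u i ≡ v i) → funToFin u ≡ funToFin v
  funToFin-cong {ℕ.zero} eq = refl
  funToFin-cong {suc m} eq = cong₂ combine (eq zero) (funToFin-cong (eq ∘ suc))
  inj : ∀ c d → (∀ i → f (finToFun c i) ≈ f (finToFun d i)) → c ≡ d
  inj c d eq = trans (≡.sym (funToFin-finToFin {n} {k} c))
    (trans (funToFin-cong (λ i → f-inj _ _ (eq i))) (funToFin-finToFin {n} {k} d))
  code : (Fin n → A) → Fin n → Fin k
  code u i = proj₁ (f-surj (u i) tt)
  decode : ∀ u i → f (finToFun (funToFin (code u)) i) ≈ u i
  decode u i =
    subst (λ j → f j ≈ u i) (≡.sym (finToFun-funToFin (code u) i)) (proj₂ (f-surj (u i) tt))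

injective⇒surjective : ∀ {m n} {f : Fin m → Fin n} → n ≤ m → Injective _≡_ _≡_ f →
  ∀ y → ∃ λ x → f x ≡ y
injective⇒surjective {m} {suc n} {f} n≤m f-inj y with any? (λ x → f x ≟ y)
... | yes hit = hit
... | no miss = ⊥-elim (1+n≰n (≤-trans n≤m (injective⇒≤ {f = missed} missed-inj)))
  where
  missed : Fin m → Fin n
  missed x = punchOut {i = y} (λ y≡fx → miss (x , ≡.sym y≡fx))
  missed-inj : Injective _≡_ _≡_ missed
  missed-inj = f-inj ∘ punchOut-injective {i = y} _ _

IsIso : Graph n → Graph n → Permutation′ n → Set
IsIso U H π = ∀ i j → adj H (π ⟨$⟩ʳ i) (π ⟨$⟩ʳ j) ≡ adj U i j

AutIso : Graph n → Graph n → Graph n → Set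
AutIso G U H = ∃ λ g → IsAut G g × IsIso U H g

Copy : Graph n → Graph n → Graph n → Set
Copy U G H = SpanningSub H G × Isomorphic U H

IsIso-id : IsIso U U id
IsIso-id _ _ = refl

IsIso-∘ : IsIso U H π → IsIso H K σ → IsIso U K (π ∘ₚ σ)
IsIso-∘ π-iso σ-iso i j = trans (σ-iso _ _) (π-iso i j)

IsIso-flip : IsIso U H π → IsIso H U (flip π)
IsIso-flip {H = H} {π = π} π-iso i j =
  trans (≡.sym (π-iso _ _)) (cong₂ (adj H) (inverseʳ π) (inverseʳ π))

IsIso-resp-≈P : π ≈P σ → IsIso U H σ → IsIso U H π
IsIso-resp-≈P {H = H} π≈σ σ-iso i j = trans (cong₂ (adj H) (π≈σ i) (π≈σ j)) (σ-iso i j)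

IsIso-resp-≈G : H ≈G K → IsIso U H π → IsIso U K π
IsIso-resp-≈G H≈K π-iso i j = trans (≡.sym (H≈K _ _)) (π-iso i j)

SpanningSub-IsIso : IsAut G π → IsIso U H π → SpanningSub U G → SpanningSub H G
SpanningSub-IsIso {G = G} {π = π} {U = U} {H = H} π-aut π-iso U⊆G i j Hij =
  trans (≡.sym (IsIso-flip {U = G} {H = G} {π = π} π-aut i j))
        (U⊆G _ _ (trans (IsIso-flip {U = U} {H = H} {π = π} π-iso i j) Hij))

act : Permutation′ n → Graph n → Graph n
act π U = record
  { adj    = λ i j → adj U (π ⟨$⟩ˡ i) (π ⟨$⟩ˡ j)
  ; sym    = λ i j → sym U _ _
  ; irrefl = λ i → irrefl U _
  }

IsIso-act : ∀ π (U : Graph n) → IsIso U (act π U) π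
IsIso-act π U i j = cong₂ (adj U) (inverseˡ π) (inverseˡ π)

conj : Permutation′ n → Permutation′ n → Permutation′ n
conj g π = g ∘ₚ (π ∘ₚ flip g)

conj-cong : ∀ (g : Permutation′ n) → π ≈P σ → conj g π ≈P conj g σ
conj-cong g π≈σ x = cong (g ⟨$⟩ˡ_) (π≈σ _)

conj-inverse : ∀ (g π : Permutation′ n) → conj (flip g) (conj g π) ≈P π
conj-inverse g π x = trans (inverseʳ g) (cong (π ⟨$⟩ʳ_) (inverseʳ g))

conj-injective : ∀ (g : Permutation′ n) → conj g π ≈P conj g σ → π ≈P σ
conj-injective {π = π} {σ = σ} g eq x =
  trans (≡.sym (conj-inverse g π x))
    (trans (conj-cong {π = conj g π} {σ = conj g σ} (flip g) eq x) (conj-inverse g σ x))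

∘ₚ-flip-cancelʳ : ∀ {ρ ρ′ : Permutation′ n} →
  ρ ≡ ρ′ → (π ∘ₚ flip ρ) ≈P (σ ∘ₚ flip ρ′) → π ≈P σ
∘ₚ-flip-cancelʳ {ρ = ρ} refl eq x =
  trans (≡.sym (inverseʳ ρ)) (trans (cong (ρ ⟨$⟩ʳ_) (eq x)) (inverseʳ ρ))

IsIso-conj : IsIso U H g → IsAut H π → IsAut U (conj g π)
IsIso-conj {U = U} {H = H} {g = g} {π = π} g-iso π-aut =
  IsIso-∘ {U = U} {H = H} {π = g} {K = U} {σ = π ∘ₚ flip g} g-iso
    (IsIso-∘ {U = H} {H = H} {π = π} {K = U} {σ = flip g} π-aut
      (IsIso-flip {U = U} {H = H} {π = g} g-iso))

IsIso? : ∀ (U H : Graph n) π → Dec (IsIso U H π)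
IsIso? U H π = all? λ i → all? λ j → adj H (π ⟨$⟩ʳ i) (π ⟨$⟩ʳ j) ≟ᵇ adj U i j

SpanningSub? : ∀ (H G : Graph n) → Dec (SpanningSub H G)
SpanningSub? H G = all? λ i → all? λ j → (adj H i j ≟ᵇ true) →-dec (adj G i j ≟ᵇ true)

permutations-HasSize : ∀ n → Σ ℕ λ p → HasSize {Permutation′ n} _≈P_ (λ _ → ⊤) p
permutations-HasSize n
  with HasSize-filter (HasSize-→ {_≈_ = _≡_} (↔⇒HasSize (↔-id (Fin n))) n)
                      IsInjective IsInjective? resp
  where
  IsInjective : (Fin n → Fin n) → Set
  IsInjective f = ∀ x y → f x ≡ f y → x ≡ y
  IsInjective? : ∀ f → Dec (IsInjective f)
  IsInjective? f = all? λ x → all? λ y → (f x ≟ f y) →-dec (x ≟ y)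
  resp : ∀ {f g} → (∀ i → f i ≡ g i) → IsInjective g → IsInjective f
  resp f≗g g-inj x y eq = g-inj x y (trans (≡.sym (f≗g x)) (trans eq (f≗g y)))
... | p , f , f-inj , f-inj-inj , f-surj =
  p , (λ i → toPermutation (f i) (proj₂ (f-inj i))) , (λ _ → tt) , f-inj-inj ,
  λ π _ → f-surj (π ⟨$⟩ʳ_)
    (tt , λ x y eq → trans (≡.sym (inverseˡ π)) (trans (cong (π ⟨$⟩ˡ_) eq) (inverseˡ π)))
  where
  toPermutation : ∀ (h : Fin n → Fin n) → (∀ x y → h x ≡ h y → x ≡ y) → Permutation′ n
  toPermutation h h-inj =
    permutation h (proj₁ ∘ h-surj) (proj₂ ∘ h-surj) (λ x → h-inj _ _ (proj₂ (h-surj (h x))))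
    where
    h-surj : ∀ y → ∃ λ x → h x ≡ y
    h-surj = injective⇒surjective ≤-refl (h-inj _ _)

graphs-HasSize : ∀ n → Σ ℕ λ g → HasSize {Graph n} _≈G_ (λ _ → ⊤) g
graphs-HasSize n
  with HasSize-filter relations IsSimple IsSimple? resp
  where
  relations : HasSize (λ R S → ∀ i j → R i j ≡ S i j) (λ _ → ⊤) ((2 ^ n) ^ n)
  relations = HasSize-→ {_≈_ = λ u v → ∀ j → u j ≡ v j}
                (HasSize-→ {_≈_ = _≡_} (↔⇒HasSize 2↔Bool) n) n
  IsSimple : (Fin n → Fin n → Bool) → Set
  IsSimple R = (∀ i j → R i j ≡ R j i) × (∀ i → R i i ≡ false)
  IsSimple? : ∀ R → Dec (IsSimple R)
  IsSimple? R = (all? λ i → all? λ j → R i j ≟ᵇ R j i) ×-dec (all? λ i → R i i ≟ᵇ false)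
  resp : ∀ {R S} → (∀ i j → R i j ≡ S i j) → IsSimple S → IsSimple R
  resp R≈S (S-sym , S-irrefl) =
    (λ i j → trans (R≈S i j) (trans (S-sym i j) (≡.sym (R≈S j i)))) ,
    (λ i → trans (R≈S i i) (S-irrefl i))
... | g , R , R-simple , R-inj , R-surj =
  g , graph , (λ _ → tt) , R-inj , λ H _ → R-surj (adj H) (tt , sym H , irrefl H)
  where
  graph : Fin g → Graph n
  graph k = record
    { adj = R k ; sym = proj₁ (proj₂ (R-simple k)) ; irrefl = proj₂ (proj₂ (R-simple k)) }

autCount-exists : ∀ (G : Graph n) → Σ ℕ (AutCount G)
autCount-exists {n} G
  with HasSize-filter {_≈_ = _≈P_} (proj₂ (permutations-HasSize n)) (IsAut G) (IsIso? G G)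
                      (λ {π} {σ} → IsIso-resp-≈P {π = π} {σ = σ} {U = G} {H = G})
... | a , A = a , HasSize-⇔ {_≈_ = _≈P_} (λ _ → proj₂) (λ _ → tt ,_) A

autCapCount-exists : ∀ {a} (U G : Graph n) → AutCount G a → Σ ℕ (AutCapCount U G)
autCapCount-exists U G A
  with HasSize-filter {_≈_ = _≈P_} A (IsAut U) (IsIso? U U)
                      (λ {π} {σ} → IsIso-resp-≈P {π = π} {σ = σ} {U = U} {H = U})
... | b , B =
  b , HasSize-⇔ {_≈_ = _≈P_} (λ _ (πG , πU) → πU , πG) (λ _ (πU , πG) → πG , πU) B

Isomorphic? : ∀ (U H : Graph n) → Dec (Isomorphic U H)
Isomorphic? {n} U H =
  HasSize-any? {_≈_ = _≈P_} (proj₂ (permutations-HasSize n)) (IsIso U H) (IsIso? U H)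
               (λ {π} {σ} → IsIso-resp-≈P {π = π} {σ = σ} {U = U} {H = H})

sCount-exists : ∀ (U G : Graph n) → Σ ℕ (SCount U G)
sCount-exists {n} U G
  with HasSize-filter {_≈_ = _≈G_} (proj₂ (graphs-HasSize n)) (Copy U G)
                      (λ H → SpanningSub? H G ×-dec Isomorphic? U H) (λ {H} {K} → resp {H} {K})
  where
  resp : ∀ {H K} → H ≈G K → Copy U G K → Copy U G H
  resp {H} {K} H≈K (K⊆G , π , π-iso) =
    (λ i j Hij → K⊆G i j (trans (≡.sym (H≈K i j)) Hij)) ,
    π , IsIso-resp-≈G {H = K} {K = H} {U = U} {π = π} (λ i j → ≡.sym (H≈K i j)) π-iso
... | s , S = s , HasSize-⇔ {_≈_ = _≈G_} (λ _ → proj₂) (λ _ → tt ,_) S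

copies-transitive : ∀ {a s b} → SpanningSub U G →
  AutCount G a → SCount U G s → AutCapCount U G b → s * b ≡ a →
  Copy U G H → AutIso G U H
copies-transitive {n} {U} {G} {H} {a} {s} {b} U⊆G
  (π , π-aut , π-inj , π-surj) (T , _ , _ , T-surj) (τ , _ , _ , τ-surj) sb≡a H-copy =
  π i , π-aut i , IsIso-resp-≈G {H = T (orbit i)} {K = H} {U = U} {π = π i} T≈H (orbit-iso i)
  where
  orbit-spec : ∀ i → ∃ λ k → T k ≈G act (π i) U
  orbit-spec i = T-surj (act (π i) U)
    ( SpanningSub-IsIso {G = G} {π = π i} {U = U} {H = act (π i) U}
        (π-aut i) (IsIso-act (π i) U) U⊆G
    , π i , IsIso-act (π i) U)

  orbit : Fin a → Fin s
  orbit = proj₁ ∘ orbit-spec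

  orbit-iso : ∀ i → IsIso U (T (orbit i)) (π i)
  orbit-iso i = IsIso-resp-≈G {H = act (π i) U} {K = T (orbit i)} {U = U} {π = π i}
    (λ x y → ≡.sym (proj₂ (orbit-spec i) x y)) (IsIso-act (π i) U)

  identity : Fin a
  identity = proj₁ (π-surj id (IsIso-id {U = G}))

  -- The fallback index is never used: it is only reached for copies outside the orbit of U.
  representative : Fin s → Fin a
  representative k with any? (λ i → orbit i ≟ k)
  ... | yes (i , _) = i
  ... | no _ = identity

  representative-orbit : ∀ i → orbit (representative (orbit i)) ≡ orbit i
  representative-orbit i with any? (λ j → orbit j ≟ orbit i)
  ... | yes (_ , eq) = eq
  ... | no miss = ⊥-elim (miss (i , refl))

  ρ : Fin a → Permutation′ n
  ρ i = π (representative (orbit i))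

  ρ-iso : ∀ i → IsIso U (T (orbit i)) (ρ i)
  ρ-iso i = subst (λ k → IsIso U (T k) (ρ i)) (representative-orbit i)
                  (orbit-iso (representative (orbit i)))

  stabiliser-spec : ∀ i → ∃ λ l → τ l ≈P (π i ∘ₚ flip (ρ i))
  stabiliser-spec i = τ-surj (π i ∘ₚ flip (ρ i))
    ( IsIso-∘ {U = U} {H = T (orbit i)} {π = π i} {K = U} {σ = flip (ρ i)}
        (orbit-iso i) (IsIso-flip {U = U} {H = T (orbit i)} {π = ρ i} (ρ-iso i))
    , IsIso-∘ {U = G} {H = G} {π = π i} {K = G} {σ = flip (ρ i)}
        (π-aut i) (IsIso-flip {U = G} {H = G} {π = ρ i} (π-aut (representative (orbit i)))))

  stabiliser : Fin a → Fin b
  stabiliser = proj₁ ∘ stabiliser-spec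

  coordinates : Fin a → Fin (s * b)
  coordinates i = combine (orbit i) (stabiliser i)

  coordinates-injective : Injective _≡_ _≡_ coordinates
  coordinates-injective {i} {j} eq =
    π-inj i j (∘ₚ-flip-cancelʳ {π = π i} {σ = π j} {ρ = ρ i} {ρ′ = ρ j}
                 (cong (π ∘ representative) same-orbit) same-τ)
    where
    same-orbit : orbit i ≡ orbit j
    same-orbit = combine-injectiveˡ (orbit i) (stabiliser i) (orbit j) (stabiliser j) eq
    same-stabiliser : stabiliser i ≡ stabiliser j
    same-stabiliser = combine-injectiveʳ (orbit i) (stabiliser i) (orbit j) (stabiliser j) eq
    same-τ : (π i ∘ₚ flip (ρ i)) ≈P (π j ∘ₚ flip (ρ j))
    same-τ x = trans (≡.sym (proj₂ (stabiliser-spec i) x))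
      (trans (cong (λ l → τ l ⟨$⟩ʳ x) same-stabiliser) (proj₂ (stabiliser-spec j) x))

  H-index : ∃ λ k → T k ≈G H
  H-index = T-surj H H-copy

  hit : ∃ λ i → coordinates i ≡ combine (proj₁ H-index) (stabiliser identity)
  hit = injective⇒surjective {f = coordinates} (≤-reflexive sb≡a) coordinates-injective _

  i : Fin a
  i = proj₁ hit

  T≈H : T (orbit i) ≈G H
  T≈H = subst (λ k → T k ≈G H) (≡.sym (combine-injectiveˡ _ _ _ _ (proj₂ hit))) (proj₂ H-index)

fixing⇒transitive : IsFixing U G → Copy U G H → AutIso G U H
fixing⇒transitive {U = U} {G = G} {H = H} (U⊆G , count-equation) H-copy =
  copies-transitive {U = U} {G = G} {H = H} U⊆G (proj₂ auts) (proj₂ copies) (proj₂ common-auts)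
    (count-equation _ _ _ (proj₂ copies) (proj₂ auts) (proj₂ common-auts)) H-copy
  where
  auts : Σ ℕ (AutCount G)
  auts = autCount-exists G
  copies : Σ ℕ (SCount U G)
  copies = sCount-exists U G
  common-auts : Σ ℕ (AutCapCount U G)
  common-auts = autCapCount-exists U G (proj₂ auts)

Isomorphic⇒SCount : ∀ {s} → Isomorphic U H → SCount H G s → SCount U G s
Isomorphic⇒SCount {U = U} {H = H} {G = G} (π , π-iso) =
  HasSize-⇔ {_≈_ = _≈G_}
    (λ K (K⊆G , σ , σ-iso) →
       K⊆G , π ∘ₚ σ , IsIso-∘ {U = U} {H = H} {π = π} {K = K} {σ = σ} π-iso σ-iso)
    (λ K (K⊆G , σ , σ-iso) → K⊆G , flip π ∘ₚ σ ,
       IsIso-∘ {U = H} {H = U} {π = flip π} {K = K} {σ = σ}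
         (IsIso-flip {U = U} {H = H} {π = π} π-iso) σ-iso)

AutCapCount-transport : ∀ {b} → AutIso G U H → AutCapCount H G b → AutCapCount U G b
AutCapCount-transport {G = G} {U = U} {H = H} (g , g-aut , g-iso) (h , h-aut , h-inj , h-surj) =
  conj g ∘ h ,
  (λ k → IsIso-conj {U = U} {H = H} {g = g} {π = h k} g-iso (proj₁ (h-aut k)) ,
         IsIso-conj {U = G} {H = G} {g = g} {π = h k} g-aut (proj₂ (h-aut k))) ,
  (λ k l eq → h-inj k l (conj-injective {π = h k} {σ = h l} g eq)) ,
  λ π (π-U , π-G) →
    let (k , hk≈) = h-surj (conj (flip g) π)
          ( IsIso-conj {U = H} {H = U} {g = flip g} {π = π}
              (IsIso-flip {U = U} {H = H} {π = g} g-iso) π-U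
          , IsIso-conj {U = G} {H = G} {g = flip g} {π = π}
              (IsIso-flip {U = G} {H = G} {π = g} g-aut) π-G)
    in k , λ x → trans (conj-cong {π = h k} {σ = conj (flip g) π} g hk≈ x)
                       (conj-inverse (flip g) π x)

IsFixing-transport : AutIso G U H → SpanningSub H G → IsFixing U G → IsFixing H G
IsFixing-transport {G = G} {U = U} {H = H} t@(g , _ , g-iso) H⊆G (_ , count-equation) =
  H⊆G , λ s a b S A B →
    count-equation s a b (Isomorphic⇒SCount {U = U} {H = H} {G = G} (g , g-iso) S) A
      (AutCapCount-transport {G = G} {U = U} {H = H} t B)

Aut⊆-transport : AutIso G U H → (∀ π → IsAut U π → IsAut G π) → ∀ π → IsAut H π → IsAut G π
Aut⊆-transport {G = G} {U = U} {H = H} (g , g-aut , g-iso) AU⊆AG π π-H =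
  IsIso-resp-≈P {π = π} {σ = conj (flip g) (conj g π)} {U = G} {H = G}
    (λ x → ≡.sym (conj-inverse g π x))
    (IsIso-conj {U = G} {H = G} {g = flip g} {π = conj g π}
      (IsIso-flip {U = G} {H = G} {π = g} g-aut)
      (AU⊆AG (conj g π) (IsIso-conj {U = U} {H = H} {g = g} {π = π} g-iso π-H)))

corollary4 : ∀ {n : ℕ} (G U U₀ : Graph n) →
    IsFixing U G → SpanningSub U₀ G → Isomorphic U U₀ →
    IsFixing U₀ G × (IsStrongFixing U G → IsStrongFixing U₀ G)
corollary4 G U U₀ U-fixing U₀⊆G U≅U₀ =
  U₀-fixing , λ (_ , AU⊆AG) → U₀-fixing , Aut⊆-transport {G = G} {U = U} {H = U₀} transport AU⊆AG
  where
  transport : AutIso G U U₀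
  transport = fixing⇒transitive {U = U} {G = G} {H = U₀} U-fixing (U₀⊆G , U≅U₀)
  U₀-fixing : IsFixing U₀ G
  U₀-fixing = IsFixing-transport {G = G} {U = U} {H = U₀} transport U₀⊆G U-fixing
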